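{- Let $a,b$ be integers with $2\leq a\leq b$. Then $$a^{b-1}\cdot b^{a-1}\geq P_a(a+b-1)\cdot P_b(a+b-1).$$
   Context: For positive integers $k,m$, $P_k(m)$ denotes the number of integer partitions of $m$ into exactly $k$ (positive) parts. -}

module Defs where

open import Data.Nat using (ℕ; zero; suc; _+_; _∸_; _≤?_)
open import Relation.Nullary.Decidable using (does)
open import Data.Bool using (if_then_else_)

-- PartsBounded k m b : the number of ways to write m as a sum
-- x₁ + … + x_k with b ≥ x₁ ≥ x₂ ≥ … ≥ x_k ≥ 1 (i.e. partitions of m
-- into exactly k positive parts, each part at most b).
-- Direct enumeration: choose the largest part x₁ = j ∈ {1,…,b} (with j ≤ m),
-- then partition the remainder m ∸ j into k-1 parts each at most j.
PartsBounded : ℕ → ℕ → ℕ → ℕ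
PartsBounded zero    zero    b = 1
PartsBounded zero    (suc m) b = 0
PartsBounded (suc k) m zero    = 0
PartsBounded (suc k) m (suc b) =
  PartsBounded (suc k) m b
  + (if does (suc b ≤? m) then PartsBounded k (m ∸ suc b) (suc b) else 0)

-- P k m : number of integer partitions of m into exactly k positive parts.
-- Every part of such a partition is at most m, so bounding by m loses nothing.
P : ℕ → ℕ → ℕ
P k m = PartsBounded k m m

module Submission where

open import Defs
open import Data.Nat using (ℕ; zero; suc; _+_; _*_; _∸_; _^_; _≤_; _<_; _≥_; z≤n; s≤s⁻¹; z<s; _≤?_)
open import Data.Nat.Properties
open import Data.Bool using (if_then_else_)
open import Relation.Nullary.Decidable using (Dec; does; yes; no)
open import Relation.Binary.PropositionalEquality using (_≡_; refl; cong; cong₂; subst; sym; module ≡-Reasoning)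

-- Peeling off the
-- largest part t + 1 of a partition of k + 1 + s into k + 1 parts leaves a
-- partition of k + (s - t) into k parts, so by induction on k
--   P (k + 1) (k + 1 + s) ≤ Σ_{t ≤ s} k ^ (s - t) ≤ (k + 1) ^ s.
-- The corollary applies this twice, with s = b - 1 and s = a - 1; of the
-- hypotheses 2 ≤ a ≤ b only a, b ≥ 1 is needed.

if-does-elim : ∀ {p q} {P : Set p} (Q : ℕ → Set q) {x : ℕ} (P? : Dec P) →
               (P → Q x) → Q 0 → Q (if does P? then x else 0)
if-does-elim Q (yes p) Qx _  = Qx p
if-does-elim Q (no _)  _  Q0 = Q0

PartsBounded-too-few : ∀ k m b → m < k → PartsBounded k m b ≡ 0
PartsBounded-too-few (suc k) m zero    _   = refl
PartsBounded-too-few (suc k) m (suc b) m<k =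
  cong₂ _+_ (PartsBounded-too-few (suc k) m b m<k)
            (if-does-elim (_≡ 0) (suc b ≤? m) remainder-too-few refl)
  where
  remainder-too-few : suc b ≤ m → PartsBounded k (m ∸ suc b) (suc b) ≡ 0
  remainder-too-few b<m = PartsBounded-too-few k (m ∸ suc b) (suc b)
    (<-≤-trans (∸-monoʳ-< z<s b<m) (s≤s⁻¹ m<k))

-- geomSum b s is the sum of the (at most) b largest terms of Σ_{t ≤ s} k ^ t, namely
-- k ^ s + … + k ^ (s ∸ (b ∸ 1)), and geomTerm b s is the next one
-- (0 once b > s).
module Geometric (k : ℕ) where

  geomTerm : ℕ → ℕ → ℕ
  geomTerm zero    s       = k ^ s
  geomTerm (suc b) zero    = 0
  geomTerm (suc b) (suc s) = geomTerm b s

  geomSum : ℕ → ℕ → ℕ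
  geomSum zero    s       = 0
  geomSum (suc b) zero    = 1
  geomSum (suc b) (suc s) = k ^ suc s + geomSum b s

  geomSum-suc : ∀ b s → geomSum (suc b) s ≡ geomSum b s + geomTerm b s
  geomSum-suc zero    zero    = refl
  geomSum-suc zero    (suc s) = +-comm (k ^ suc s) 0
  geomSum-suc (suc b) zero    = refl
  geomSum-suc (suc b) (suc s) = begin
    k ^ suc s + geomSum (suc b) s              ≡⟨ cong (k ^ suc s +_) (geomSum-suc b s) ⟩
    k ^ suc s + (geomSum b s + geomTerm b s)   ≡⟨ +-assoc (k ^ suc s) (geomSum b s) (geomTerm b s) ⟨
    k ^ suc s + geomSum b s + geomTerm b s     ∎
    where open ≡-Reasoning

  geomSum-≤ : ∀ b s → geomSum b s ≤ suc k ^ s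
  geomSum-≤ zero    s       = z≤n
  geomSum-≤ (suc b) zero    = ≤-refl
  geomSum-≤ (suc b) (suc s) = begin
    k ^ suc s + geomSum b s        ≤⟨ +-mono-≤ (*-monoʳ-≤ k (^-monoˡ-≤ s (n≤1+n k))) (geomSum-≤ b s) ⟩
    k * suc k ^ s + suc k ^ s      ≡⟨ +-comm (k * suc k ^ s) (suc k ^ s) ⟩
    suc k ^ suc s                  ∎
    where open ≤-Reasoning

module PartsBoundedStep (k : ℕ) (IH : ∀ s c → PartsBounded k (k + s) c ≤ k ^ s) where
  open Geometric k

  PartsBounded-≤-geomTerm : ∀ b s c → b ≤ k + s → PartsBounded k (k + s ∸ b) c ≤ geomTerm b s
  PartsBounded-≤-geomTerm zero    s       c _   = IH s c
  PartsBounded-≤-geomTerm (suc b) zero    c b<k = ≤-reflexive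
    (PartsBounded-too-few k (k + 0 ∸ suc b) c
      (<-≤-trans (∸-monoʳ-< z<s b<k) (≤-reflexive (+-identityʳ k))))
  PartsBounded-≤-geomTerm (suc b) (suc s) c b≤k+s rewrite +-suc k s =
    PartsBounded-≤-geomTerm b s c (s≤s⁻¹ b≤k+s)

  PartsBounded-suc-≤-geomSum : ∀ b s → PartsBounded (suc k) (suc k + s) b ≤ geomSum b s
  PartsBounded-suc-≤-geomSum zero    s = z≤n
  PartsBounded-suc-≤-geomSum (suc b) s = begin
    PartsBounded (suc k) (suc k + s) (suc b)
      ≤⟨ +-mono-≤ (PartsBounded-suc-≤-geomSum b s)
                  (if-does-elim (_≤ geomTerm b s) (suc b ≤? suc k + s)
                    (λ b<m → PartsBounded-≤-geomTerm b s (suc b) (s≤s⁻¹ b<m)) z≤n) ⟩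
    geomSum b s + geomTerm b s
      ≡⟨ geomSum-suc b s ⟨
    geomSum (suc b) s ∎
    where open ≤-Reasoning

PartsBounded-≤-pow : ∀ k s c → PartsBounded k (k + s) c ≤ k ^ s
PartsBounded-≤-pow zero    zero    c = ≤-refl
PartsBounded-≤-pow zero    (suc s) c = z≤n
PartsBounded-≤-pow (suc k) s       c =
  ≤-trans (PartsBounded-suc-≤-geomSum c s) (geomSum-≤ c s)
  where
  open Geometric k
  open PartsBoundedStep k (PartsBounded-≤-pow k)

P-≤-pow : ∀ k s → P k (k + s) ≤ k ^ s
P-≤-pow k s = PartsBounded-≤-pow k s (k + s)

corollary2p3p1 : (a b : ℕ) → 2 ≤ a → a ≤ b →
    a ^ (b ∸ 1) * b ^ (a ∸ 1) ≥ P a (a + b ∸ 1) * P b (a + b ∸ 1)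
corollary2p3p1 (suc a) (suc b) _ _ = *-mono-≤ Pa≤ Pb≤
  where
  Pa≤ : P (suc a) (a + suc b) ≤ suc a ^ b
  Pa≤ = subst (λ m → P (suc a) m ≤ suc a ^ b) (sym (+-suc a b)) (P-≤-pow (suc a) b)
  Pb≤ : P (suc b) (a + suc b) ≤ suc b ^ a
  Pb≤ = subst (λ m → P (suc b) m ≤ suc b ^ a) (sym (+-comm a (suc b))) (P-≤-pow (suc b) a)
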